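{- Let $\kappa$ be a cardinal and let $c:\kappa\times\omega\times\omega\to 2$ be a tortuous coloring. Then for every infinite $A\subseteq\omega$ there exists $\alpha<\kappa$ such that for every $n\in\omega$ and every $\sigma\in 2^{n+1}$, there are infinitely many $k\in A$ with $\sigma(i)=c(\alpha,k,i)$ for all $i<n+1$.
   Context: A partition of $\kappa$ is a sequence $\langle K_n:n\in\omega\rangle$ of pairwise disjoint (possibly empty) subsets of $\kappa$ with union $\kappa$. A coloring $c:\kappa\times\omega\times\omega\to2$ is tortuous if for each infinite $A\subseteq\omega$ and each partition $\langle K_n:n\in\omega\rangle$ of $\kappa$ there is $n\in\omega$ such that for every $\sigma\in2^{n+1}$ there exist $\alpha\in K_n$ and $k\in A$ with $k>n$ and $\sigma(i)=c(\alpha,k,i)$ for all $i<n+1$. -}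

module Defs where

open import Data.Nat using (ℕ; suc; _≤_; _<_)
open import Data.Fin using (Fin; toℕ)
open import Data.Bool using (Bool)
open import Data.Product using (Σ; ∃; _×_)
open import Relation.Binary.PropositionalEquality using (_≡_)

Infinite : (ℕ → Set) → Set
Infinite A = ∀ m → ∃ λ k → m ≤ k × A k

record Partition (κ : Set) : Set₁ where
  field
    part     : ℕ → κ → Set
    disjoint : ∀ m n (α : κ) → part m α → part n α → m ≡ n
    covers   : ∀ (α : κ) → ∃ λ n → part n α
open Partition public

Agrees : {κ : Set} → (κ → ℕ → ℕ → Bool) → κ → ℕ → (n : ℕ) → (Fin (suc n) → Bool) → Set
Agrees c α k n σ = ∀ (i : Fin (suc n)) → σ i ≡ c α k (toℕ i)

Tortuous : (κ : Set) → (κ → ℕ → ℕ → Bool) → Set₁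
Tortuous κ c =
  (A : ℕ → Set) → Infinite A → (P : Partition κ) →
  ∃ λ n → (σ : Fin (suc n) → Bool) →
    Σ κ λ α → part P n α × ∃ λ k → A k × n < k × Agrees c α k n σ

-- Suppose no colour α realises every finite 0-1 pattern infinitely often inside A. Then, classically,
-- each α comes with a finite string s α that is realised by no k ∈ A with k ≥ |s α|. Partition κ by
-- an injective numbering of these strings that dominates their length. Tortuousness yields a piece K_N
-- in which every σ ∈ 2^(N+1) is realised above N; it is nonempty, so take the string s of one of its
-- members and let σ extend it. The α ∈ K_N realising σ has s α = s, and realises it at some k > N ≥ |s|.
module Submission where

open import Defs
open import Data.Nat using (ℕ; zero; suc; _+_; _≤_; _<_; z≤n; s≤s)
open import Data.Nat.Properties using (≤-trans; <-≤-trans; m≤m+n; m≤n+m; <⇒≤)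
open import Data.Nat.Binary.Base using (ℕᵇ; 2[1+_]; 1+[2_]) renaming (zero to 0ᵇ; toℕ to ℕᵇ→ℕ)
open import Data.Nat.Binary.Properties using (2[1+_]-injective; 1+[2_]-injective)
  renaming (toℕ-injective to ℕᵇ→ℕ-injective)
open import Data.Fin using (Fin; toℕ; fromℕ<)
open import Data.Fin.Properties using (toℕ-fromℕ<; toℕ<n)
open import Data.Bool using (Bool; true; false)
open import Data.List using (List; []; _∷_; _++_; length; tabulate; replicate)
open import Data.List.Properties using (length-++; length-tabulate; length-replicate)
open import Data.Product using (Σ; ∃; _×_; _,_; proj₁; proj₂)
open import Level using (0ℓ)
open import Axiom.ExcludedMiddle using (ExcludedMiddle)
open import Axiom.DoubleNegationElimination using (em⇒dne)
open import Function using (_∘_)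
open import Function.Definitions using (Injective)
open import Relation.Nullary using (¬_)
open import Relation.Binary.PropositionalEquality using (_≡_; refl; sym; trans; cong; cong₂; subst)

¬∀⇒∃¬ : ExcludedMiddle 0ℓ → {X : Set} {P : X → Set} → ¬ (∀ x → P x) → ∃ λ x → ¬ P x
¬∀⇒∃¬ em ¬∀P = em⇒dne em λ ¬∃¬P → ¬∀P λ x → em⇒dne em λ ¬Px → ¬∃¬P (x , ¬Px)

fibres : {κ : Set} → (κ → ℕ) → Partition κ
fibres f = record
  { part     = λ n α → f α ≡ n
  ; disjoint = λ m n α fα≡m fα≡n → trans (sym fα≡m) fα≡n
  ; covers   = λ α → f α , refl
  }

-- Reading past the end of the string yields false.
_!_ : List Bool → ℕ → Bool
[]       ! _     = false
(b ∷ bs) ! zero  = b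
(b ∷ bs) ! suc i = bs ! i

tabulate-++-! : ∀ {n} (σ : Fin n → Bool) (ys : List Bool) (i : Fin n) →
                (tabulate σ ++ ys) ! toℕ i ≡ σ i
tabulate-++-! σ ys Fin.zero    = refl
tabulate-++-! σ ys (Fin.suc i) = tabulate-++-! (λ j → σ (Fin.suc j)) ys i

_⊑_ : List Bool → (ℕ → Bool) → Set
bs ⊑ f = ∀ i → i < length bs → bs ! i ≡ f i

⊑-fromFin : ∀ {n} (bs : List Bool) (f : ℕ → Bool) → length bs ≤ n →
            (∀ (i : Fin n) → bs ! toℕ i ≡ f (toℕ i)) → bs ⊑ f
⊑-fromFin {n} bs f |bs|≤n agree i i<|bs| =
  subst (λ j → bs ! j ≡ f j) (toℕ-fromℕ< i<n) (agree (fromℕ< i<n))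
  where
  i<n : i < n
  i<n = <-≤-trans i<|bs| |bs|≤n

toℕᵇ : List Bool → ℕᵇ
toℕᵇ []           = 0ᵇ
toℕᵇ (true ∷ bs)  = 1+[2 toℕᵇ bs ]
toℕᵇ (false ∷ bs) = 2[1+ toℕᵇ bs ]

toℕᵇ-injective : Injective _≡_ _≡_ toℕᵇ
toℕᵇ-injective {[]}         {[]}         _ = refl
toℕᵇ-injective {true ∷ bs}  {true ∷ cs}  p = cong (true ∷_) (toℕᵇ-injective (1+[2_]-injective p))
toℕᵇ-injective {false ∷ bs} {false ∷ cs} p = cong (false ∷_) (toℕᵇ-injective (2[1+_]-injective p))
toℕᵇ-injective {[]}         {true ∷ _}   ()
toℕᵇ-injective {[]}         {false ∷ _}  ()
toℕᵇ-injective {true ∷ _}   {[]}         ()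
toℕᵇ-injective {true ∷ _}   {false ∷ _}  ()
toℕᵇ-injective {false ∷ _}  {[]}         ()
toℕᵇ-injective {false ∷ _}  {true ∷ _}   ()

code : List Bool → ℕ
code bs = ℕᵇ→ℕ (toℕᵇ bs)

code-injective : Injective _≡_ _≡_ code
code-injective = toℕᵇ-injective ∘ ℕᵇ→ℕ-injective

length≤code : ∀ bs → length bs ≤ code bs
length≤code []           = z≤n
length≤code (true ∷ bs)  = s≤s (≤-trans (length≤code bs) (m≤m+n (code bs) _))
length≤code (false ∷ bs) = ≤-trans (s≤s (length≤code bs)) (m≤m+n (suc (code bs)) _)

module _ {κ : Set} (c : κ → ℕ → ℕ → Bool) (A : ℕ → Set) where

  Realises : κ → List Bool → Set
  Realises α bs = ∃ λ k → A k × length bs ≤ k × bs ⊑ c α k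

  -- Padding σ with m zeros forces the witness k to lie above m.
  realises-all⇒agrees-unboundedly :
    ∀ α → (∀ bs → Realises α bs) →
    (n : ℕ) (σ : Fin (suc n) → Bool) (m : ℕ) → ∃ λ k → m ≤ k × A k × Agrees c α k n σ
  realises-all⇒agrees-unboundedly α realises n σ m with realises (tabulate σ ++ replicate m false)
  ... | k , Ak , |bs|≤k , bs⊑ = k , m≤k , Ak , agrees
    where
    |bs|≡ : length (tabulate σ ++ replicate m false) ≡ suc n + m
    |bs|≡ = trans (length-++ (tabulate σ)) (cong₂ _+_ (length-tabulate σ) (length-replicate m))
    m≤k : m ≤ k
    m≤k = ≤-trans (m≤n+m m (suc n)) (subst (_≤ k) |bs|≡ |bs|≤k)
    agrees : Agrees c α k n σ
    agrees i = trans (sym (tabulate-++-! σ _ i)) (bs⊑ (toℕ i) i<|bs|)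
      where
      i<|bs| : toℕ i < length (tabulate σ ++ replicate m false)
      i<|bs| = subst (toℕ i <_) (sym |bs|≡) (<-≤-trans (toℕ<n i) (m≤m+n (suc n) m))

  tortuous⇒realises-some : Tortuous κ c → Infinite A → (s : κ → List Bool) → ∃ λ α → Realises α (s α)
  tortuous⇒realises-some tortuous infinite s with tortuous A infinite (fibres (code ∘ s))
  ... | N , realised with realised (λ _ → false)
  ... | α₀ , code-sα₀≡N , _ with realised (λ i → s α₀ ! toℕ i)
  ... | α , code-sα≡N , k , Ak , N<k , agrees = α , k , Ak , |sα|≤k , sα⊑
    where
    sα≡sα₀ : s α ≡ s α₀
    sα≡sα₀ = code-injective (trans code-sα≡N (sym code-sα₀≡N))
    |sα|≤N : length (s α) ≤ N
    |sα|≤N = subst (length (s α) ≤_) code-sα≡N (length≤code (s α))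
    |sα|≤k : length (s α) ≤ k
    |sα|≤k = ≤-trans |sα|≤N (<⇒≤ N<k)
    sα⊑ : s α ⊑ c α k
    sα⊑ = ⊑-fromFin (s α) (c α k) (≤-trans |sα|≤N (m≤n+m N 1))
            (λ i → trans (cong (λ bs → bs ! toℕ i) sα≡sα₀) (agrees i))

lemma2p6 : ExcludedMiddle 0ℓ → (κ : Set) → (c : κ → ℕ → ℕ → Bool) → Tortuous κ c →
    (A : ℕ → Set) → Infinite A →
    Σ κ λ α → (n : ℕ) → (σ : Fin (suc n) → Bool) →
    (m : ℕ) → ∃ λ k → m ≤ k × A k × Agrees c α k n σ
lemma2p6 em κ c tortuous A infinite = em⇒dne em λ noneGood →
  let unrealised : ∀ α → ∃ λ bs → ¬ Realises c A α bs
      unrealised α = ¬∀⇒∃¬ em λ realises →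
        noneGood (α , realises-all⇒agrees-unboundedly c A α realises)
      α , realised = tortuous⇒realises-some c A tortuous infinite (λ α → proj₁ (unrealised α))
  in proj₂ (unrealised α) realised
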